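{- Let $\beta\in S_n$ and let $k$ be a positive integer. Then there is no $\alpha\in S_n$ that $k$-commutes with $\beta$ in such a way that its $k$ bad commuting points lie in $k$ distinct cycles of $\beta$, each of these cycles containing exactly one bad commuting point; that is, $c(\lambda_{k^{(k)}},\beta)=0$.
   Context: $S_n$ is the symmetric group on $[n]$, products composed right to left; cycles of a permutation include fixed points as $1$-cycles. A point $a$ is a bad commuting point of $\alpha,\beta$ if $\alpha\beta(a)\ne\beta\alpha(a)$; $\alpha$ $k$-commutes with $\beta$ if there are exactly $k$ bad commuting points. $c(\lambda_{k^{(k)}},\beta)$ denotes the number of $\alpha$ that $k$-commute with $\beta$ with the bad commuting points lying in exactly $k$ cycles of $\beta$, one in each. -}

module Defs where

open import Data.Nat using (ℕ; zero; suc)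
open import Data.Fin using (Fin; _≟_)
open import Data.Fin.Permutation using (Permutation′; _⟨$⟩ʳ_)
open import Data.List using (List; filter; length; allFin)
open import Data.Product using (∃)
open import Relation.Binary.PropositionalEquality using (_≡_; _≢_)
open import Relation.Nullary using (¬_)
open import Relation.Unary using (Decidable)
open import Relation.Nullary.Decidable using (¬?)

Perm : ℕ → Set
Perm n = Permutation′ n

_^[_]_ : ∀ {n} → Perm n → ℕ → Fin n → Fin n
β ^[ zero ] a = a
β ^[ suc m ] a = β ⟨$⟩ʳ (β ^[ m ] a)

-- a is a bad commuting point of α, β:  αβ(a) ≠ βα(a)  (products right to left).
BadPoint : ∀ {n} → Perm n → Perm n → Fin n → Set
BadPoint α β a = α ⟨$⟩ʳ (β ⟨$⟩ʳ a) ≢ β ⟨$⟩ʳ (α ⟨$⟩ʳ a)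

badPoint? : ∀ {n} (α β : Perm n) → Decidable (BadPoint α β)
badPoint? α β a = ¬? (α ⟨$⟩ʳ (β ⟨$⟩ʳ a) ≟ β ⟨$⟩ʳ (α ⟨$⟩ʳ a))

badPoints : ∀ {n} → Perm n → Perm n → List (Fin n)
badPoints α β = filter (badPoint? α β) (allFin _)

KCommutes : ∀ {n} → ℕ → Perm n → Perm n → Set
KCommutes k α β = length (badPoints α β) ≡ k

SameCycle : ∀ {n} → Perm n → Fin n → Fin n → Set
SameCycle β a b = ∃ λ m → β ^[ m ] a ≡ b

-- Together with
-- KCommutes k α β this says the k bad points lie in exactly k cycles of β,
-- one in each (the pattern λ_{k^{(k)}}).
BadPointsInDistinctCycles : ∀ {n} → Perm n → Perm n → Set
BadPointsInDistinctCycles α β =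
  ∀ a b → BadPoint α β a → BadPoint α β b → a ≢ b → ¬ SameCycle β a b

module Submission where

-- Key fact (`successor-image-longer`): if a is the only bad point of its
-- β-cycle, of length M, then α maps βa, β²a, …, βᴹa = a onto the β-path
-- y, βy, …, βᴹ⁻¹y with y = αβa, and badness of a forces βᴹy ≠ y; so the
-- β-cycle of y is longer than M.
--
-- Now take a bad point a whose β-cycle has maximal length M.  The points
-- on β-cycles longer than M form a β-invariant set on which α commutes
-- with β, so α maps it into itself; since α is a permutation of a finite
-- set it also reflects it (`invariant-reflects`).  As αβa = y lies in
-- that set, so does βa — but βa lies on a cycle of length M.

open import Defs
open import Data.Nat using (ℕ; _≥_)
open import Data.Product using (∃; _×_)
open import Relation.Nullary using (¬_)

open import Data.Nat using (zero; suc; _+_; _∸_; _≤_; _<_; s≤s; z≤n)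
open import Data.Nat.Properties
  using (+-comm; +-suc; +-identityʳ; m∸n+n≡m; m<n⇒0<n∸m; n<1+n; <⇒≤; ≤-refl; ≤-pred; m≤n⇒m<n∨m≡n)
open import Data.Fin using (Fin; toℕ; _≟_)
open import Data.Fin.Properties using (pigeonhole)
open import Data.Fin.Permutation using (_⟨$⟩ʳ_)
open import Data.Product using (_,_; proj₁; proj₂)
open import Data.Sum using (inj₁; inj₂)
open import Data.List using (List; _∷_; length; filter; allFin)
open import Data.List.Relation.Unary.All using (All; _∷_; lookup)
open import Data.List.Relation.Unary.All.Properties using (all-filter)
open import Data.List.Membership.Propositional.Properties using (∈-filter⁺; ∈-allFin)
open import Data.List.Extrema.Nat using (argmax; argmax-all; f[xs]≤f[argmax])
open import Function.Bundles using (Injection)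
open import Function.Properties.Inverse using (↔⇒↣)
open import Relation.Nullary using (Dec; yes; no; contradiction)
open import Relation.Nullary.Decidable using (decidable-stable)
open import Relation.Unary using (Pred; Decidable)
open import Level using (0ℓ)
open import Relation.Binary.PropositionalEquality
  using (_≡_; _≢_; refl; sym; trans; cong; subst; module ≡-Reasoning)

⟨$⟩ʳ-injective : ∀ {n} (π : Perm n) {u v} → π ⟨$⟩ʳ u ≡ π ⟨$⟩ʳ v → u ≡ v
⟨$⟩ʳ-injective π = Injection.injective (↔⇒↣ π)

^-injective : ∀ {n} (π : Perm n) m {u v} → π ^[ m ] u ≡ π ^[ m ] v → u ≡ v
^-injective π zero    e = e
^-injective π (suc m) e = ^-injective π m (⟨$⟩ʳ-injective π e)

^-+ : ∀ {n} (π : Perm n) m i x → π ^[ m + i ] x ≡ π ^[ m ] (π ^[ i ] x)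
^-+ π zero    i x = refl
^-+ π (suc m) i x = cong (π ⟨$⟩ʳ_) (^-+ π m i x)

^-shift : ∀ {n} (π : Perm n) j x → π ^[ j ] (π ⟨$⟩ʳ x) ≡ π ⟨$⟩ʳ (π ^[ j ] x)
^-shift π zero    x = refl
^-shift π (suc j) x = cong (π ⟨$⟩ʳ_) (^-shift π j x)

-- Every point returns to itself: among x, πx, …, πⁿx two coincide
-- (pigeonhole), and cancelling the smaller power gives a positive return time.
^-returns : ∀ {n} (π : Perm n) x → ∃ λ r → 1 ≤ r × π ^[ r ] x ≡ x
^-returns {n} π x with pigeonhole (n<1+n n) (λ (i : Fin (suc n)) → π ^[ toℕ i ] x)
... | i , j , i<j , πⁱx≡πʲx = toℕ j ∸ toℕ i , m<n⇒0<n∸m i<j , ^-injective π (toℕ i) cancelled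
  where
  open ≡-Reasoning
  d = toℕ j ∸ toℕ i
  cancelled : π ^[ toℕ i ] (π ^[ d ] x) ≡ π ^[ toℕ i ] x
  cancelled = begin
    π ^[ toℕ i ] (π ^[ d ] x) ≡⟨ sym (^-+ π (toℕ i) d x) ⟩
    π ^[ toℕ i + d ] x        ≡⟨ cong (λ m → π ^[ m ] x) (trans (+-comm (toℕ i) d) (m∸n+n≡m (<⇒≤ i<j))) ⟩
    π ^[ toℕ j ] x            ≡⟨ sym πⁱx≡πʲx ⟩
    π ^[ toℕ i ] x            ∎

Least : (ℕ → Set) → Set
Least P = ∃ λ m → P m × (∀ j → j < m → ¬ P j)

module _ (P : ℕ → Set) (P? : ∀ m → Dec (P m)) where

  least-from : ∀ i d → (∀ j → j < i → ¬ P j) → P (d + i) → Least P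
  least-from i d below p with P? i
  least-from i d       below p | yes pᵢ = i , pᵢ , below
  least-from i zero    below p | no ¬pᵢ = contradiction p ¬pᵢ
  least-from i (suc d) below p | no ¬pᵢ =
    least-from (suc i) d below′ (subst P (sym (+-suc d i)) p)
    where
    below′ : ∀ j → j < suc i → ¬ P j
    below′ j j<1+i with m≤n⇒m<n∨m≡n (≤-pred j<1+i)
    ... | inj₁ j<i  = below j j<i
    ... | inj₂ refl = ¬pᵢ

  least : ∀ {r} → P r → Least P
  least {r} p = least-from 0 r (λ _ ()) (subst P (sym (+-identityʳ r)) p)

module Period {n} (π : Perm n) where

  -- Abstract, so that the computation behind the period is never unfolded
  -- during type checking.
  private abstract
    first-return : ∀ x → Least (λ m → π ^[ suc m ] x ≡ x)
    first-return x with ^-returns π x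
    ... | suc r , _ , πʳx≡x = least (λ m → π ^[ suc m ] x ≡ x) (λ m → π ^[ suc m ] x ≟ x) {r} πʳx≡x

  period : Fin n → ℕ
  period x = suc (proj₁ (first-return x))

  period-returns : ∀ x → π ^[ period x ] x ≡ x
  period-returns x = proj₁ (proj₂ (first-return x))

  period-minimal : ∀ x j → 1 ≤ j → j < period x → π ^[ j ] x ≢ x
  period-minimal x (suc j) _ (s≤s j<m) = proj₂ (proj₂ (first-return x)) j j<m

Invariant : ∀ {n} → Perm n → Pred (Fin n) 0ℓ → Set
Invariant π S = ∀ x → S x → S (π ⟨$⟩ʳ x)

invariant-^ : ∀ {n} (π : Perm n) {S : Pred (Fin n) 0ℓ} → Invariant π S → ∀ j x → S x → S (π ^[ j ] x)
invariant-^ π inv zero    x s = s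
invariant-^ π inv (suc j) x s = inv _ (invariant-^ π inv j x s)

-- A permutation of a finite set that maps S into S also reflects S:
-- x = πʳx = πʳ⁻¹(πx) for a return time r ≥ 1 of x.
invariant-reflects : ∀ {n} (π : Perm n) {S : Pred (Fin n) 0ℓ} → Invariant π S → ∀ x → S (π ⟨$⟩ʳ x) → S x
invariant-reflects π {S} inv x s with ^-returns π x
... | suc r , _ , πʳx≡x = subst S (trans (^-shift π r x) πʳx≡x) (invariant-^ π inv r _ s)

Commutes : ∀ {n} → Perm n → Perm n → Fin n → Set
Commutes α β x = α ⟨$⟩ʳ (β ⟨$⟩ʳ x) ≡ β ⟨$⟩ʳ (α ⟨$⟩ʳ x)

not-bad⇒commutes : ∀ {n} (α β : Perm n) x → ¬ BadPoint α β x → Commutes α β x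
not-bad⇒commutes α β x = decidable-stable (α ⟨$⟩ʳ (β ⟨$⟩ʳ x) ≟ β ⟨$⟩ʳ (α ⟨$⟩ʳ x))

commutes-^ : ∀ {n} (α β : Perm n) {S : Pred (Fin n) 0ℓ} → Invariant β S →
             (∀ x → S x → Commutes α β x) → ∀ x → S x → ∀ j → α ⟨$⟩ʳ (β ^[ j ] x) ≡ β ^[ j ] (α ⟨$⟩ʳ x)
commutes-^ α β inv comm x s zero    = refl
commutes-^ α β inv comm x s (suc j) =
  trans (comm _ (invariant-^ β inv j x s)) (cong (β ⟨$⟩ʳ_) (commutes-^ α β inv comm x s j))

LongerThan : ∀ {n} → Perm n → ℕ → Fin n → Set
LongerThan β M x = ∀ j → 1 ≤ j → j ≤ M → β ^[ j ] x ≢ x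

longerThan-invariant : ∀ {n} (β : Perm n) M → Invariant β (LongerThan β M)
longerThan-invariant β M x long j 1≤j j≤M βʲβx≡βx =
  long j 1≤j j≤M (⟨$⟩ʳ-injective β (trans (sym (^-shift β j x)) βʲβx≡βx))

-- If α commutes with β on the points of cycle length > M, it preserves them:
-- βʲ(αx) = αx gives α(βʲx) = αx, hence βʲx = x.
commuting-preserves-longer : ∀ {n} (α β : Perm n) M →
  (∀ x → LongerThan β M x → Commutes α β x) → Invariant α (LongerThan β M)
commuting-preserves-longer α β M comm x long j 1≤j j≤M βʲαx≡αx =
  long j 1≤j j≤M (⟨$⟩ʳ-injective α (trans (commutes-^ α β (longerThan-invariant β M) comm x long j) βʲαx≡αx))

module _ {n} (α β : Perm n) (a : Fin n) (bad : BadPoint α β a)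
         (cycle-commutes : ∀ i → 1 ≤ i → i < Period.period β a → Commutes α β (β ^[ i ] a)) where

  open Period β

  private
    y : Fin n
    y = α ⟨$⟩ʳ (β ⟨$⟩ʳ a)

    walk : ∀ j → suc j ≤ period a → α ⟨$⟩ʳ (β ^[ suc j ] a) ≡ β ^[ j ] y
    walk zero    _    = refl
    walk (suc j) 2+j≤M =
      trans (cycle-commutes (suc j) (s≤s z≤n) 2+j≤M) (cong (β ⟨$⟩ʳ_) (walk j (<⇒≤ 2+j≤M)))

  successor-image-longer : LongerThan β (period a) (α ⟨$⟩ʳ (β ⟨$⟩ʳ a))
  successor-image-longer (suc j) _ 1+j≤M βʲ⁺¹y≡y with m≤n⇒m<n∨m≡n 1+j≤M
  -- j + 1 < M: then α(βʲ⁺²a) = α(βa), so βʲ⁺¹a = a below the period.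
  ... | inj₁ 1+j<M = period-minimal a (suc j) (s≤s z≤n) 1+j<M
    (⟨$⟩ʳ-injective β (trans (sym (^-shift β (suc j) a))
      (⟨$⟩ʳ-injective α (trans (cong (α ⟨$⟩ʳ_) (^-shift β (suc j) a)) (trans (walk (suc j) 1+j<M) βʲ⁺¹y≡y)))))
  -- j + 1 = M: then βʲy = α(βᴹa) = αa, so βαa = βᴹy = y = αβa, i.e. a is not bad.
  ... | inj₂ refl = bad (trans (sym βʲ⁺¹y≡y) (cong (β ⟨$⟩ʳ_) βʲy≡αa))
    where
    βʲy≡αa : β ^[ j ] y ≡ α ⟨$⟩ʳ a
    βʲy≡αa = trans (sym (walk j ≤-refl)) (cong (α ⟨$⟩ʳ_) (period-returns a))

maximal-witness : ∀ {n} {P : Pred (Fin n) 0ℓ} → Decidable P → (f : Fin n → ℕ) →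
                  ∃ P → ∃ λ a → P a × (∀ b → P b → f b ≤ f a)
maximal-witness {n} {P} P? f (a₀ , pa₀) = a , argmax-all f pa₀ (all-filter P? (allFin n)) , maximal
  where
  witnesses : List (Fin n)
  witnesses = filter P? (allFin n)
  a : Fin n
  a = argmax f a₀ witnesses
  maximal : ∀ b → P b → f b ≤ f a
  maximal b pb = lookup (f[xs]≤f[argmax] {f = f} a₀ witnesses) (∈-filter⁺ P? (∈-allFin b) pb)

All⇒∃ : ∀ {A : Set} {P : Pred A 0ℓ} {xs : List A} → All P xs → 1 ≤ length xs → ∃ P
All⇒∃ (px ∷ _) _ = _ , px

kCommutes⇒bad-point : ∀ {n} (α β : Perm n) {k} → KCommutes k α β → k ≥ 1 → ∃ (BadPoint α β)
kCommutes⇒bad-point {n} α β kc k≥1 =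
  All⇒∃ (all-filter (badPoint? α β) (allFin n)) (subst (1 ≤_) (sym kc) k≥1)

no-bad-point : ∀ {n} (α β : Perm n) → BadPointsInDistinctCycles α β → ¬ ∃ (BadPoint α β)
no-bad-point α β distinct some-bad with maximal-witness (badPoint? α β) (Period.period β) some-bad
... | a , bad , maximal =
  βa-not-longer (invariant-reflects α preserves-longer (β ⟨$⟩ʳ a) (successor-image-longer α β a bad cycle-commutes))
  where
  open Period β
  M = period a

  -- Bad points have period ≤ M, so points on longer cycles commute.
  longer⇒commutes : ∀ x → LongerThan β M x → Commutes α β x
  longer⇒commutes x long =
    not-bad⇒commutes α β x λ bad-x → long (period x) (s≤s z≤n) (maximal x bad-x) (period-returns x)

  preserves-longer : Invariant α (LongerThan β M)
  preserves-longer = commuting-preserves-longer α β M longer⇒commutes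

  -- The other points of the cycle of a are distinct from a, hence not bad.
  cycle-commutes : ∀ i → 1 ≤ i → i < M → Commutes α β (β ^[ i ] a)
  cycle-commutes i 1≤i i<M = not-bad⇒commutes α β _ λ bad-βⁱa →
    distinct a (β ^[ i ] a) bad bad-βⁱa (λ a≡βⁱa → period-minimal a i 1≤i i<M (sym a≡βⁱa)) (i , refl)

  βa-not-longer : ¬ LongerThan β M (β ⟨$⟩ʳ a)
  βa-not-longer long = long M (s≤s z≤n) ≤-refl (trans (^-shift β M a) (cong (β ⟨$⟩ʳ_) (period-returns a)))

proposition15 : ∀ (n : ℕ) (β : Perm n) (k : ℕ) → k ≥ 1 →
    ¬ (∃ λ (α : Perm n) → KCommutes k α β × BadPointsInDistinctCycles α β)
proposition15 n β k k≥1 (α , k-commutes , distinct) =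
  no-bad-point α β distinct (kCommutes⇒bad-point α β k-commutes k≥1)
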